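{- Let $t \ge 3$ and let $(H,J)$ be a $2$-separation in a graph $G$ with $V(H)\cap V(J) = \{x,y\}$. If $G$ contains a standard $K_{2,t}$ minor $(R_1,R_2;S)$, then at least one of the following holds: (i) $H+xy$ has a $K_{2,t}$ minor; (ii) $J+xy$ has a $K_{2,t}$ minor; (iii) $x \in R_1$ and $y \in R_2$, or $x \in R_2$ and $y \in R_1$.
   Context: A $k$-separation in $G$ is a pair $(H,J)$ of edge-disjoint subgraphs of $G$ with $G = H \cup J$, $|V(H)\cap V(J)| = k$, $V(H)-V(J) \ne \emptyset$ and $V(J)-V(H)\ne\emptyset$. $H+xy$ denotes $H$ with the edge $xy$ added (if not already present). A standard $K_{2,t}$ minor in $G$ is a triple $(R_1,R_2;S)$ where $R_1,R_2 \subseteq V(G)$ are disjoint, each induces a connected subgraph, $S=\{s_1,\ldots,s_t\}$ is a set of $t$ vertices disjoint from $R_1\cup R_2$, and each $s_i$ has a neighbour in $R_1$ and a neighbour in $R_2$. Graphs are simple and minors are taken in the usual sense. -}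

module Defs where

open import Data.Nat using (ℕ)
open import Data.Fin using (Fin)
open import Data.Bool using (Bool; T)
open import Data.Product using (Σ; ∃; _×_; _,_)
open import Data.Sum using (_⊎_)
open import Data.Empty using (⊥)
open import Relation.Nullary using (¬_)
open import Relation.Binary.PropositionalEquality using (_≡_; _≢_)

VSet : ℕ → Set
VSet n = Fin n → Bool

ERel : ℕ → Set
ERel n = Fin n → Fin n → Bool

record SimpleGraph (n : ℕ) : Set where
  field
    adj    : ERel n
    sym    : ∀ u v → T (adj u v) → T (adj v u)
    irrefl : ∀ v → ¬ T (adj v v)
open SimpleGraph public

record Subgraph {n : ℕ} (G : SimpleGraph n) : Set where
  field
    vert      : VSet n
    edge      : ERel n
    edge⊆adj  : ∀ u v → T (edge u v) → T (adj G u v)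
    edge-sym  : ∀ u v → T (edge u v) → T (edge v u)
    edge-ends : ∀ u v → T (edge u v) → T (vert u) × T (vert v)
open Subgraph public

data Walk {n : ℕ} (E : Fin n → Fin n → Set) (B : Fin n → Set)
     : Fin n → Fin n → Set where
  here : ∀ {u} → B u → Walk E B u u
  step : ∀ {u w v} → B u → E u w → Walk E B w v → Walk E B u v

Connected : {n : ℕ} → (Fin n → Fin n → Set) → (Fin n → Set) → Set
Connected E B = ∀ u v → B u → B v → Walk E B u v

-- Vertices of K_{2,t}: the two "big" vertices inj₁ i, and inj₂ j for j < t.
K2V : ℕ → Set
K2V t = Fin 2 ⊎ Fin t

HasK2tMinor : {n : ℕ} → ℕ → (Fin n → Set) → (Fin n → Fin n → Set) → Set
HasK2tMinor {n} t V E =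
  Σ (K2V t → VSet n) λ β →
      (∀ a v → T (β a v) → V v)
    × (∀ a → ∃ λ v → T (β a v))
    × (∀ a → Connected E (λ v → T (β a v)))
    × (∀ a b → a ≢ b → ∀ v → T (β a v) → T (β b v) → ⊥)
    × (∀ i j → ∃ λ u → ∃ λ v →
         T (β (Data.Sum.inj₁ i) u) × T (β (Data.Sum.inj₂ j) v) × E u v)

PlusVert : {n : ℕ} {G : SimpleGraph n} → Subgraph G → Fin n → Set
PlusVert H v = T (vert H v)

PlusEdge : {n : ℕ} {G : SimpleGraph n} → Subgraph G → Fin n → Fin n
         → Fin n → Fin n → Set
PlusEdge H x y u v = T (edge H u v) ⊎ ((u ≡ x × v ≡ y) ⊎ (u ≡ y × v ≡ x))

record IsTwoSeparation {n : ℕ} (G : SimpleGraph n) (H J : Subgraph G)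
                       (x y : Fin n) : Set where
  field
    x≢y        : x ≢ y
    cover-vert : ∀ v → T (vert H v) ⊎ T (vert J v)
    cover-edge : ∀ u v → T (adj G u v) → T (edge H u v) ⊎ T (edge J u v)
    edge-disj  : ∀ u v → T (edge H u v) → T (edge J u v) → ⊥
    inter→     : ∀ v → T (vert H v) → T (vert J v) → v ≡ x ⊎ v ≡ y
    x∈H        : T (vert H x)
    x∈J        : T (vert J x)
    y∈H        : T (vert H y)
    y∈J        : T (vert J y)
    H-J≠∅      : ∃ λ v → T (vert H v) × ¬ T (vert J v)
    J-H≠∅      : ∃ λ v → T (vert J v) × ¬ T (vert H v)

record IsStandardK2t {n : ℕ} (G : SimpleGraph n) (t : ℕ)
                     (R₁ R₂ : VSet n) (S : Fin t → Fin n) : Set where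
  field
    R-disj   : ∀ v → T (R₁ v) → T (R₂ v) → ⊥
    R₁-conn  : Connected (λ u v → T (adj G u v)) (λ v → T (R₁ v))
    R₂-conn  : Connected (λ u v → T (adj G u v)) (λ v → T (R₂ v))
    S-inj    : ∀ i j → S i ≡ S j → i ≡ j
    S∉R₁     : ∀ i → ¬ T (R₁ (S i))
    S∉R₂     : ∀ i → ¬ T (R₂ (S i))
    S-nbr₁   : ∀ i → ∃ λ u → T (R₁ u) × T (adj G (S i) u)
    S-nbr₂   : ∀ i → ∃ λ u → T (R₂ u) × T (adj G (S i) u)

-- If every vertex of S lies in H, some s ∈ S avoids {x, y}, so s ∉ J and all
-- neighbours of s lie in H; hence both R₁ ∩ V(H) and R₂ ∩ V(H) are nonempty.
-- A walk of G inside Rₖ between two vertices of H can only leave H through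
-- x or y and re-enter through x or y, so replacing each excursion by the edge
-- xy shows that Rₖ ∩ V(H) is connected in H + xy, and (Rₖ ∩ V(H), Rₖ' ∩ V(H);
-- S) is a K_{2,t} minor of H + xy. Symmetrically for J. Otherwise S meets both
-- V(H) − V(J) and V(J) − V(H); each connected Rₖ has neighbours of both of
-- these vertices, so it meets {x, y}, and as R₁, R₂ are disjoint they
-- contain one of x, y each.
module Submission where

open import Defs
open import Data.Nat using (ℕ; _≤_; s≤s)
open import Data.Fin using (Fin; zero; suc; _≟_)
open import Data.Fin.Properties using (all?; ¬∀⟶∃¬)
open import Data.Bool using (T; _∧_)
open import Data.Bool.Properties using (T-∧)
open import Data.Product using (_×_; ∃; _,_; proj₁; proj₂)
open import Data.Sum using (_⊎_; inj₁; inj₂; swap)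
open import Data.Empty using (⊥; ⊥-elim)
open import Function.Bundles using (Equivalence)
open import Relation.Nullary using (¬_; yes; no; contradiction)
open import Relation.Nullary.Decidable using (T?; _⊎-dec_; ⌊_⌋; toWitness; fromWitness)
open import Relation.Binary.PropositionalEquality
  using (_≡_; _≢_; refl; trans; cong) renaming (sym to ≡-sym)

private
  variable
    n : ℕ

Adj : SimpleGraph n → Fin n → Fin n → Set
Adj G u v = T (adj G u v)

walk-map : ∀ {E E′ : Fin n → Fin n → Set} {B B′ : Fin n → Set} {u v} →
           (∀ {a b} → E a b → E′ a b) → (∀ {a} → B a → B′ a) →
           Walk E B u v → Walk E′ B′ u v
walk-map f g (here b)       = here (g b)
walk-map f g (step b e w) = step (g b) (f e) (walk-map f g w)

walk-head : ∀ {E : Fin n → Fin n → Set} {B : Fin n → Set} {u v} → Walk E B u v → B u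
walk-head (here b)       = b
walk-head (step b _ _) = b

two-of-three : ∀ {A : Set} {x y a b c : A} →
               (a ≡ x ⊎ a ≡ y) → (b ≡ x ⊎ b ≡ y) → (c ≡ x ⊎ c ≡ y) →
               a ≡ b ⊎ a ≡ c ⊎ b ≡ c
two-of-three (inj₁ refl) (inj₁ refl) _           = inj₁ refl
two-of-three (inj₂ refl) (inj₂ refl) _           = inj₁ refl
two-of-three (inj₁ refl) (inj₂ refl) (inj₁ refl) = inj₂ (inj₁ refl)
two-of-three (inj₁ refl) (inj₂ refl) (inj₂ refl) = inj₂ (inj₂ refl)
two-of-three (inj₂ refl) (inj₁ refl) (inj₁ refl) = inj₂ (inj₂ refl)
two-of-three (inj₂ refl) (inj₁ refl) (inj₂ refl) = inj₂ (inj₁ refl)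

injective-avoids-pair : ∀ {t} → 3 ≤ t → (S : Fin t → Fin n) →
                        (∀ i j → S i ≡ S j → i ≡ j) → (x y : Fin n) →
                        ∃ λ j → ¬ (S j ≡ x ⊎ S j ≡ y)
injective-avoids-pair (s≤s (s≤s (s≤s _))) S inj x y
  with pair? zero | pair? (suc zero) | pair? (suc (suc zero))
  where pair? = λ i → (S i ≟ x) ⊎-dec (S i ≟ y)
... | no a  | _     | _     = zero , a
... | _     | no b  | _     = suc zero , b
... | _     | _     | no c  = suc (suc zero) , c
... | yes a | yes b | yes c with two-of-three a b c
...   | inj₁ e        = contradiction (inj _ _ e) λ ()
...   | inj₂ (inj₁ e) = contradiction (inj _ _ e) λ ()
...   | inj₂ (inj₂ e) = contradiction (inj _ _ e) λ ()

IsTwoSeparation-swap : ∀ {G : SimpleGraph n} {H J x y} →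
                       IsTwoSeparation G H J x y → IsTwoSeparation G J H x y
IsTwoSeparation-swap sep = record
  { x≢y        = x≢y
  ; cover-vert = λ v → swap (cover-vert v)
  ; cover-edge = λ u v e → swap (cover-edge u v e)
  ; edge-disj  = λ u v e f → edge-disj u v f e
  ; inter→     = λ v p q → inter→ v q p
  ; x∈H = x∈J ; x∈J = x∈H ; y∈H = y∈J ; y∈J = y∈H
  ; H-J≠∅ = J-H≠∅ ; J-H≠∅ = H-J≠∅
  }
  where open IsTwoSeparation sep

module TwoSeparation {G : SimpleGraph n} {H J : Subgraph G} {x y : Fin n}
                     (sep : IsTwoSeparation G H J x y) where
  open IsTwoSeparation sep

  InH InJ Boundary : Fin n → Set
  InH v      = T (vert H v)
  InJ v      = T (vert J v)
  Boundary v = v ≡ x ⊎ v ≡ y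

  Edge⁺ : Fin n → Fin n → Set
  Edge⁺ = PlusEdge H x y

  boundary-inH : ∀ {z} → Boundary z → InH z
  boundary-inH (inj₁ refl) = x∈H
  boundary-inH (inj₂ refl) = y∈H

  boundary-edge⁺ : ∀ {u z} → Boundary u → Boundary z → u ≢ z → Edge⁺ u z
  boundary-edge⁺ (inj₁ refl) (inj₁ refl) u≢z = contradiction refl u≢z
  boundary-edge⁺ (inj₁ refl) (inj₂ refl) _   = inj₂ (inj₁ (refl , refl))
  boundary-edge⁺ (inj₂ refl) (inj₁ refl) _   = inj₂ (inj₂ (refl , refl))
  boundary-edge⁺ (inj₂ refl) (inj₂ refl) u≢z = contradiction refl u≢z

  inH-inJ⇒boundary : ∀ {v} → InH v → InJ v → Boundary v
  inH-inJ⇒boundary = inter→ _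

  adj⇒edge⁺ : ∀ {u w} → Adj G u w → InH u → InH w → Edge⁺ u w
  adj⇒edge⁺ {u} {w} e uH wH with cover-edge u w e
  ... | inj₁ eH = inj₁ eH
  ... | inj₂ eJ = boundary-edge⁺ (inH-inJ⇒boundary uH (proj₁ (edge-ends J u w eJ)))
                                 (inH-inJ⇒boundary wH (proj₂ (edge-ends J u w eJ)))
                                 λ { refl → irrefl G u e }

  leaving-H⇒boundary : ∀ {u w} → Adj G u w → InH u → ¬ InH w → Boundary u
  leaving-H⇒boundary {u} {w} e uH w∉H with cover-edge u w e
  ... | inj₁ eH = contradiction (proj₂ (edge-ends H u w eH)) w∉H
  ... | inj₂ eJ = inH-inJ⇒boundary uH (proj₁ (edge-ends J u w eJ))

  adj-∉J⇒inH : ∀ {u w} → Adj G u w → ¬ InJ u → InH w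
  adj-∉J⇒inH {u} {w} e u∉J with cover-edge u w e
  ... | inj₁ eH = proj₂ (edge-ends H u w eH)
  ... | inj₂ eJ = contradiction (proj₁ (edge-ends J u w eJ)) u∉J

  adj-∉H⇒inJ : ∀ {u w} → Adj G u w → ¬ InH u → InJ w
  adj-∉H⇒inJ {u} {w} e u∉H with cover-edge u w e
  ... | inj₁ eH = contradiction (proj₁ (edge-ends H u w eH)) u∉H
  ... | inj₂ eJ = proj₂ (edge-ends J u w eJ)

  Walk⁺ : (Fin n → Set) → Fin n → Fin n → Set
  Walk⁺ X = Walk Edge⁺ (λ w → X w × InH w)

  Entry : (Fin n → Set) → Fin n → Set
  Entry X v = ∃ λ z → Boundary z × Walk⁺ X z v

  -- A walk of G inside X is shortened in H + xy by replacing each excursion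
  -- outside H by the edge between its exit and re-entry points.
  walk-inside-H : ∀ {X u v} → Walk (Adj G) X u v → InH u → InH v → Walk⁺ X u v
  walk-entering-H : ∀ {X u v} → Walk (Adj G) X u v → ¬ InH u → InH v → Entry X v

  walk-inside-H (here Xu) uH _ = here (Xu , uH)
  walk-inside-H {u = u} (step {w = w} Xu e rest) uH vH with T? (vert H w)
  ... | yes wH = step (Xu , uH) (adj⇒edge⁺ e uH wH) (walk-inside-H rest wH vH)
  ... | no w∉H with walk-entering-H rest w∉H vH
  ...   | z , bz , rest⁺ with u ≟ z
  ...     | yes refl = rest⁺
  ...     | no u≢z   = step (Xu , uH) (boundary-edge⁺ (leaving-H⇒boundary e uH w∉H) bz u≢z) rest⁺

  walk-entering-H (here _) u∉H vH = contradiction vH u∉H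
  walk-entering-H (step {w = w} _ e rest) u∉H vH with T? (vert H w)
  ... | yes wH  = w , leaving-H⇒boundary (sym G _ w e) wH u∉H , walk-inside-H rest wH vH
  ... | no w∉H = walk-entering-H rest w∉H vH

  connected-∩H : ∀ {X} → Connected (Adj G) X →
                 Connected Edge⁺ (λ v → X v × InH v)
  connected-∩H c u v (Xu , uH) (Xv , vH) = walk-inside-H (c u v Xu Xv) uH vH

  connected-meets-boundary : ∀ {X} → Connected (Adj G) X → ∀ {p q} →
                             X p → X q → InH p → InJ q → ∃ λ z → Boundary z × X z
  connected-meets-boundary c {p} {q} Xp Xq pH qJ with T? (vert H q)
  ... | yes qH = q , inH-inJ⇒boundary qH qJ , Xq
  ... | no q∉H with walk-entering-H (c q p Xq Xp) q∉H pH
  ...   | z , bz , walk = z , bz , proj₁ (walk-head walk)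

  disjoint-boundary-split : ∀ {R₁ R₂ : VSet n} → (∀ v → T (R₁ v) → T (R₂ v) → ⊥) →
                            (∃ λ z → Boundary z × T (R₁ z)) → (∃ λ z → Boundary z × T (R₂ z)) →
                            (T (R₁ x) × T (R₂ y)) ⊎ (T (R₂ x) × T (R₁ y))
  disjoint-boundary-split disj (_ , inj₁ refl , p) (_ , inj₁ refl , q) = ⊥-elim (disj x p q)
  disjoint-boundary-split disj (_ , inj₁ refl , p) (_ , inj₂ refl , q) = inj₁ (p , q)
  disjoint-boundary-split disj (_ , inj₂ refl , p) (_ , inj₁ refl , q) = inj₂ (q , p)
  disjoint-boundary-split disj (_ , inj₂ refl , p) (_ , inj₂ refl , q) = ⊥-elim (disj y p q)

  module StandardK2t {t} {R₁ R₂ : VSet n} {S : Fin t → Fin n}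
                     (std : IsStandardK2t G t R₁ R₂ S) where
    open IsStandardK2t std

    R : Fin 2 → VSet n
    R zero       = R₁
    R (suc zero) = R₂

    R-connected : ∀ k → Connected (Adj G) (λ v → T (R k v))
    R-connected zero       = R₁-conn
    R-connected (suc zero) = R₂-conn

    S∉R : ∀ k i → ¬ T (R k (S i))
    S∉R zero       = S∉R₁
    S∉R (suc zero) = S∉R₂

    S-nbr : ∀ k i → ∃ λ u → T (R k u) × Adj G (S i) u
    S-nbr zero       = S-nbr₁
    S-nbr (suc zero) = S-nbr₂

    R-meets-H : ∀ {j} → ¬ InJ (S j) → ∀ k → ∃ λ p → T (R k p) × InH p
    R-meets-H S∉J k with S-nbr k _
    ... | p , Rp , e = p , Rp , adj-∉J⇒inH e S∉J

    β : K2V t → VSet n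
    β (inj₁ k) v = R k v ∧ vert H v
    β (inj₂ j) v = ⌊ v ≟ S j ⌋

    module _ (S⊆H : ∀ i → InH (S i)) (R∩H≠∅ : ∀ k → ∃ λ p → T (R k p) × InH p) where

      β-in-H : ∀ a v → T (β a v) → InH v
      β-in-H (inj₁ k) v p = proj₂ (Equivalence.to T-∧ p)
      β-in-H (inj₂ j) v p with toWitness p
      ... | refl = S⊆H j

      β-nonempty : ∀ a → ∃ λ v → T (β a v)
      β-nonempty (inj₁ k) with R∩H≠∅ k
      ... | p , Rp , pH = p , Equivalence.from T-∧ (Rp , pH)
      β-nonempty (inj₂ j) = S j , fromWitness refl

      β-connected : ∀ a → Connected Edge⁺ (λ v → T (β a v))
      β-connected (inj₁ k) u v βu βv =
        walk-map (λ e → e) (Equivalence.from T-∧)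
          (connected-∩H (R-connected k) u v (Equivalence.to T-∧ βu) (Equivalence.to T-∧ βv))
      β-connected (inj₂ j) u v βu βv with toWitness βu | toWitness βv
      ... | refl | refl = here βu

      β-disjoint : ∀ a b → a ≢ b → ∀ v → T (β a v) → T (β b v) → ⊥
      β-disjoint (inj₁ zero)       (inj₁ zero)       a≢b _ _ _ = a≢b refl
      β-disjoint (inj₁ zero)       (inj₁ (suc zero)) _   v p q =
        R-disj v (proj₁ (Equivalence.to T-∧ p)) (proj₁ (Equivalence.to T-∧ q))
      β-disjoint (inj₁ (suc zero)) (inj₁ zero)       _   v p q =
        R-disj v (proj₁ (Equivalence.to T-∧ q)) (proj₁ (Equivalence.to T-∧ p))
      β-disjoint (inj₁ (suc zero)) (inj₁ (suc zero)) a≢b _ _ _ = a≢b refl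
      β-disjoint (inj₁ k) (inj₂ j) _ v p q with toWitness q
      ... | refl = S∉R k j (proj₁ (Equivalence.to T-∧ p))
      β-disjoint (inj₂ j) (inj₁ k) _ v p q with toWitness p
      ... | refl = S∉R k j (proj₁ (Equivalence.to T-∧ q))
      β-disjoint (inj₂ i) (inj₂ j) a≢b v p q =
        a≢b (cong inj₂ (S-inj i j (trans (≡-sym (toWitness p)) (toWitness q))))

      -- If the neighbour w ∈ Rₖ of sⱼ lies outside H, then sⱼ ∈ {x, y} and Rₖ
      -- meets the other vertex of {x, y}, which is then joined to sⱼ by xy.
      β-adjacent : ∀ k j → ∃ λ u → ∃ λ v → T (β (inj₁ k) u) × T (β (inj₂ j) v) × Edge⁺ u v
      β-adjacent k j with S-nbr k j
      ... | w , Rw , e with T? (vert H w)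
      ...   | yes wH = w , S j , Equivalence.from T-∧ (Rw , wH) , fromWitness refl ,
                       adj⇒edge⁺ (sym G (S j) w e) wH (S⊆H j)
      ...   | no w∉H with R∩H≠∅ k
      ...     | p , Rp , pH with walk-entering-H (R-connected k w p Rw Rp) w∉H pH
      ...       | z , bz , walk =
                  z , S j , Equivalence.from T-∧ (proj₁ (walk-head walk) , boundary-inH bz) ,
                  fromWitness refl ,
                  boundary-edge⁺ bz (leaving-H⇒boundary e (S⊆H j) w∉H)
                                 λ { refl → S∉R k j (proj₁ (walk-head walk)) }

      K2t-minor⁺ : HasK2tMinor t (PlusVert H) Edge⁺
      K2t-minor⁺ = β , β-in-H , β-nonempty , β-connected , β-disjoint , β-adjacent

    K2t-minor-in-H⁺ : 3 ≤ t → (∀ i → InH (S i)) → HasK2tMinor t (PlusVert H) Edge⁺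
    K2t-minor-in-H⁺ 3≤t S⊆H with injective-avoids-pair 3≤t S S-inj x y
    ... | j , Sj∉xy = K2t-minor⁺ S⊆H (R-meets-H λ SjJ → Sj∉xy (inH-inJ⇒boundary (S⊆H j) SjJ))

    R-split-x-y : ∀ {a b} → ¬ InJ (S a) → ¬ InH (S b) →
              (T (R₁ x) × T (R₂ y)) ⊎ (T (R₂ x) × T (R₁ y))
    R-split-x-y {a} {b} Sa∉J Sb∉H =
      disjoint-boundary-split R-disj (R-meets-boundary zero) (R-meets-boundary (suc zero))
      where
      R-meets-boundary : ∀ k → ∃ λ z → Boundary z × T (R k z)
      R-meets-boundary k with S-nbr k a | S-nbr k b
      ... | p , Rp , ep | q , Rq , eq =
        connected-meets-boundary (R-connected k) Rp Rq (adj-∉J⇒inH ep Sa∉J) (adj-∉H⇒inJ eq Sb∉H)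

lemma3p1 : {n : ℕ} (t : ℕ) → 3 ≤ t → (G : SimpleGraph n) → (H J : Subgraph G) → (x y : Fin n)
    → IsTwoSeparation G H J x y
    → (R₁ R₂ : VSet n) (S : Fin t → Fin n) → IsStandardK2t G t R₁ R₂ S
    → HasK2tMinor t (PlusVert H) (PlusEdge H x y)
      ⊎ HasK2tMinor t (PlusVert J) (PlusEdge J x y)
      ⊎ ((T (R₁ x) × T (R₂ y)) ⊎ (T (R₂ x) × T (R₁ y)))
lemma3p1 t 3≤t G H J x y sep R₁ R₂ S std
  with all? (λ i → T? (vert H (S i))) | all? (λ i → T? (vert J (S i)))
... | yes S⊆H | _       = inj₁ (H-side.K2t-minor-in-H⁺ std 3≤t S⊆H)
  where module H-side = TwoSeparation.StandardK2t sep
... | no _    | yes S⊆J = inj₂ (inj₁ (J-side.K2t-minor-in-H⁺ std 3≤t S⊆J))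
  where module J-side = TwoSeparation.StandardK2t (IsTwoSeparation-swap sep)
... | no S⊈H  | no S⊈J  with ¬∀⟶∃¬ t _ (λ i → T? (vert H (S i))) S⊈H
                            | ¬∀⟶∃¬ t _ (λ i → T? (vert J (S i))) S⊈J
...   | _ , Sb∉H | _ , Sa∉J = inj₂ (inj₂ (TwoSeparation.StandardK2t.R-split-x-y sep std Sa∉J Sb∉H))
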